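{- Let $q$ be a prime power and $k\ge 2$, and suppose that one of the following holds: $k=2$ and $q\ge 5$; or $k\ge 4$ and $q=2$; or $k\ge 3$ and $q\ge 3$. Let $\bm{x},\bm{y}\in V$ span a $2$-dimensional subspace contained in some $q$-ary simplex code of dimension $k$. Then for every non-zero $a\in\mathbb{F}_q$ there is a vector $\bm{z}\in V$ such that each of $\langle \bm{x},\bm{z}\rangle$ and $\langle \bm{y},\bm{z}\rangle$ is contained in some simplex code of dimension $k$, and there is no simplex code of dimension $k$ containing both $\bm{z}$ and $\bm{x}+a\bm{y}$.
   Context: Let $n=[k]_q=\frac{q^k-1}{q-1}$ and $V=\mathbb{F}_q^n$. A $k$-dimensional subspace $C\subseteq V$ is a $q$-ary simplex code of dimension $k$ if the columns of a generator matrix of $C$ are non-zero and mutually non-proportional. -}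

module Defs where

open import Level using (0ℓ)
open import Data.Nat as ℕ using (ℕ; zero; suc; _^_)
open import Data.Nat.Primality using (Prime)
open import Data.Fin using (Fin; zero; suc)
open import Data.Product using (Σ; ∃; ∃-syntax; _×_; _,_)
open import Relation.Binary.PropositionalEquality using (_≡_; _≢_)
open import Relation.Nullary using (¬_)
open import Function.Bundles using (_↔_)
open import Algebra.Structures using (IsCommutativeRing)

IsPrimePower : ℕ → Set
IsPrimePower q = ∃[ p ] ∃[ m ] (Prime p × q ≡ p ^ suc m)

-- [k]_q = 1 + q + ... + q^(k-1)  ( = (q^k - 1)/(q - 1) )
[_]_ : ℕ → ℕ → ℕ
[ zero  ] q = 0
[ suc k ] q = q ^ k ℕ.+ [ k ] q

record FiniteField (q : ℕ) : Set₁ where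
  infixl 6 _+_
  infixl 7 _*_
  field
    Carrier : Set
    _+_ _*_ : Carrier → Carrier → Carrier
    -_      : Carrier → Carrier
    0# 1#   : Carrier
    isCommutativeRing : IsCommutativeRing _≡_ _+_ _*_ -_ 0# 1#
    0≢1     : 0# ≢ 1#
    inverse : ∀ x → x ≢ 0# → ∃[ y ] (x * y ≡ 1#)
    card    : Carrier ↔ Fin q

module _ {q : ℕ} (F : FiniteField q) where
  open FiniteField F

  ∑ : ∀ {m} → (Fin m → Carrier) → Carrier
  ∑ {zero}  f = 0#
  ∑ {suc m} f = f zero + ∑ (λ i → f (suc i))

  Vec : ℕ → Set
  Vec n = Fin n → Carrier

  _≈ᵥ_ : ∀ {n} → Vec n → Vec n → Set
  u ≈ᵥ v = ∀ j → u j ≡ v j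

  zeroᵥ : ∀ {n} → Vec n
  zeroᵥ _ = 0#

  _+ᵥ_ : ∀ {n} → Vec n → Vec n → Vec n
  (u +ᵥ v) j = u j + v j

  _•_ : ∀ {n} → Carrier → Vec n → Vec n
  (a • v) j = a * v j

  LinIndep₂ : ∀ {n} → Vec n → Vec n → Set
  LinIndep₂ x y = ∀ a b → ((a • x) +ᵥ (b • y)) ≈ᵥ zeroᵥ → (a ≡ 0#) × (b ≡ 0#)

  Mat : ℕ → ℕ → Set
  Mat k n = Fin k → Fin n → Carrier

  column : ∀ {k n} → Mat k n → Fin n → Vec k
  column G j i = G i j

  combo : ∀ {k n} → Mat k n → Vec k → Vec n
  combo G c j = ∑ (λ i → c i * G i j)

  RowsIndependent : ∀ {k n} → Mat k n → Set
  RowsIndependent G = ∀ c → combo G c ≈ᵥ zeroᵥ → ∀ i → c i ≡ 0#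

  IsSimplexGenerator : ∀ k → Mat k ([ k ] q) → Set
  IsSimplexGenerator k G =
    RowsIndependent G
    × (∀ j → ¬ (column G j ≈ᵥ zeroᵥ))
    × (∀ j j′ → j ≢ j′ → ∀ λ′ → ¬ (column G j ≈ᵥ (λ′ • column G j′)))

  InCode : ∀ {k n} → Mat k n → Vec n → Set
  InCode G v = ∃[ c ] (combo G c ≈ᵥ v)

  InSomeSimplex : ∀ k → Vec ([ k ] q) → Vec ([ k ] q) → Set
  InSomeSimplex k u v =
    ∃[ G ] (IsSimplexGenerator k G × InCode G u × InCode G v)

{-# OPTIONS --safe #-}
-- The columns of a simplex generator matrix represent every point of projective space exactly
-- once. Hence permuting and rescaling the positions of a simplex code gives again a simplex code,
-- and a non-zero codeword has weight at least q^(k-1) (the columns off a hyperplane).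
-- Let w = x + a y. We build z from w by two monomial transformations, one fixing x and one fixing
-- y, so that ⟨x, z⟩ and ⟨y, z⟩ lie in simplex codes. The transformations only move the entries at
-- three or four positions, which are located through the values of (x, y) there: (0, 1), (1, 0),
-- (1, a⁻¹), and, in characteristic 2, either (1, t) for a third field element t, or (0, 0) when
-- q = 2 and k ≥ 3. Then z ≠ w differ in at most 4 < q^(k-1) positions, so no simplex code
-- contains both.
module Submission where

open import Defs
open import Level using (0ℓ)
open import Data.Nat as ℕ using (ℕ; zero; suc; _^_; _≤_; z≤n; s≤s)
import Data.Nat.Properties as ℕ
open import Data.Fin.Patterns using (0F; 1F; 2F; 3F)
open import Data.Fin as Fin using (Fin; zero; suc; punchIn; punchOut; _↑ˡ_; _↑ʳ_; funToFin; finToFun)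
import Data.Fin.Properties as Fin
open import Data.Vec.Functional using (removeAt; updateAt; insertAt; []; _∷_)
open import Data.Vec.Functional.Properties using (updateAt-updates; updateAt-minimal; insertAt-lookup; removeAt-insertAt)
open import Data.Product using (∃-syntax; _×_; _,_; proj₁; proj₂)
open import Data.Sum using (_⊎_; inj₁; inj₂; [_,_]′)
open import Data.Empty using (⊥-elim)
open import Function using (_∘_; id)
open import Function.Bundles using (Inverse; Injection)
open import Function.Properties.Inverse using (↔⇒↣)
open import Function.Definitions using (Injective)
open import Data.Fin.Permutation.Components using (transpose; transpose-inverse)
open import Algebra.Bundles using (CommutativeRing)
open import Relation.Binary.Definitions using (DecidableEquality)
open import Relation.Nullary using (¬_; yes; no)
open import Relation.Nullary.Decidable using (via-injection; dec-true; dec-false; _⊎-dec_)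
open import Relation.Binary.PropositionalEquality hiding ([_])

funToFin-cong : ∀ {m n} {f g : Fin m → Fin n} → (∀ i → f i ≡ g i) → funToFin f ≡ funToFin g
funToFin-cong {zero}  f≗g = refl
funToFin-cong {suc m} f≗g = cong₂ Fin.combine (f≗g zero) (funToFin-cong (f≗g ∘ suc))

↑ˡ≢↑ʳ : ∀ {m n} (i : Fin m) (j : Fin n) → i ↑ˡ n ≢ m ↑ʳ j
↑ˡ≢↑ʳ {m} {n} i j e with trans (sym (Fin.splitAt-↑ˡ m i n)) (trans (cong (Fin.splitAt m) e) (Fin.splitAt-↑ʳ m n j))
... | ()

injective⇒surjective : ∀ {n} (f : Fin n → Fin n) → Injective _≡_ _≡_ f → ∀ t → ∃[ l ] (f l ≡ t)
injective⇒surjective {zero}  f f-inj ()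
injective⇒surjective {suc n} f f-inj t with Fin.any? (λ l → f l Fin.≟ t)
... | yes hit = hit
... | no miss = ⊥-elim (ℕ.<-irrefl refl (Fin.injective⇒≤ {f = f′} f′-injective))
  where
  t≢f : ∀ l → t ≢ f l
  t≢f l e = miss (l , sym e)
  f′ : Fin (suc n) → Fin n
  f′ l = punchOut (t≢f l)
  f′-injective : Injective _≡_ _≡_ f′
  f′-injective e = f-inj (Fin.punchOut-injective (t≢f _) (t≢f _) e)

by-positions : ∀ {m n} (P : Fin n → Set) (S : Fin m → Fin n) → (∀ t → P (S t)) →
               (∀ l → (∀ t → S t ≢ l) → P l) → ∀ l → P l
by-positions P S P-on-S P-elsewhere l with Fin.any? (λ t → S t Fin.≟ l)
... | yes (t , refl) = P-on-S t
... | no miss        = P-elsewhere l (λ t e → miss (t , e))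

transpose-matchˡ : ∀ {n} (i j : Fin n) → transpose i j i ≡ j
transpose-matchˡ i j rewrite dec-true (i Fin.≟ i) refl = refl

transpose-matchʳ : ∀ {n} (i j : Fin n) → transpose i j j ≡ i
transpose-matchʳ i j with j Fin.≟ i
... | yes j≡i = j≡i
... | no _ rewrite dec-true (j Fin.≟ j) refl = refl

transpose-other : ∀ {n} {i j k : Fin n} → k ≢ i → k ≢ j → transpose i j k ≡ k
transpose-other {i = i} {j} {k} k≢i k≢j rewrite dec-false (k Fin.≟ i) k≢i | dec-false (k Fin.≟ j) k≢j = refl

transpose-injective : ∀ {n} (i j : Fin n) → Injective _≡_ _≡_ (transpose i j)
transpose-injective i j e =
  trans (sym (transpose-inverse j i)) (trans (cong (transpose j i) e) (transpose-inverse j i))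

4<q^[k-1] : ∀ q m → (suc (suc m) ≡ 2 × 5 ≤ q) ⊎ (4 ≤ suc (suc m) × q ≡ 2) ⊎ (3 ≤ suc (suc m) × 3 ≤ q) →
            4 ℕ.< q ^ suc m
4<q^[k-1] q m (inj₁ (refl , 5≤q)) = ℕ.≤-trans 5≤q (ℕ.≤-reflexive (sym (ℕ.*-identityʳ q)))
4<q^[k-1] q m (inj₂ (inj₁ (s≤s (s≤s 2≤m) , refl))) = ℕ.≤-trans (ℕ.m≤m+n 5 3) (ℕ.^-monoʳ-≤ 2 (s≤s 2≤m))
4<q^[k-1] q m (inj₂ (inj₂ (s≤s (s≤s 1≤m) , 3≤q))) =
  ℕ.≤-trans (ℕ.m≤m+n 5 4) (ℕ.≤-trans (ℕ.^-monoʳ-≤ 3 (s≤s 1≤m)) (ℕ.^-monoˡ-≤ (suc m) 3≤q))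

[1+k]≰[2] : ∀ {q k} → q ≤ 2 → 4 ℕ.< q ^ k → ¬ ([ suc k ] q ≤ [ 2 ] q)
[1+k]≰[2] {q} {k} q≤2 4<q^k [1+k]≤[2] = ℕ.<⇒≱ (ℕ.<-≤-trans 4<q^k (ℕ.≤-trans (ℕ.m≤m+n (q ^ k) _) [1+k]≤[2]))
  (ℕ.≤-trans (ℕ.+-monoˡ-≤ 1 (ℕ.*-monoˡ-≤ 1 q≤2)) (ℕ.n≤1+n 3))

module Theory {q : ℕ} (F : FiniteField q) where
  open FiniteField F
  open Inverse card using (to; from; strictlyInverseˡ)

  commutativeRing : CommutativeRing 0ℓ 0ℓ
  commutativeRing = record { isCommutativeRing = isCommutativeRing }

  open CommutativeRing commutativeRing
    using (+-assoc; +-comm; *-assoc; *-comm; *-identityˡ; *-identityʳ; +-identityˡ; +-identityʳ;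
           zeroˡ; zeroʳ; distribˡ; distribʳ; -‿inverseˡ; -‿inverseʳ; semiring)
  open import Algebra.Properties.Ring (CommutativeRing.ring commutativeRing)
    using (-1*x≈-x; -‿distribˡ-*; x∙y⁻¹≈ε⇒x≈y; x+x≈x⇒x≈0)
  open import Algebra.Properties.CommutativeSemigroup (CommutativeRing.*-commutativeSemigroup commutativeRing)
    using () renaming (x∙yz≈y∙xz to x*[y*z]≡y*[x*z])
  open import Algebra.Properties.Semiring.Sum semiring
    using (sum; sum-cong-≗; sum-replicate-zero; sum-remove; *-distribˡ-sum)
    renaming (∑-distrib-+ to sum-distrib-+)

  infix 4 _≈_
  _≈_ : ∀ {m} → Vec F m → Vec F m → Set
  _≈_ = _≈ᵥ_ F

  0ᵥ : ∀ {m} → Vec F m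
  0ᵥ = zeroᵥ F

  infixr 7 _·_
  _·_ : ∀ {m} → Carrier → Vec F m → Vec F m
  _·_ = _•_ F

  distinguish : ∀ {m} (f : Vec F m) {l l′} → f l ≡ 0# → f l′ ≢ 0# → l ≢ l′
  distinguish f fₗ≡0 fₗ′≢0 refl = fₗ′≢0 fₗ≡0

  to-injective : ∀ {x y} → to x ≡ to y → x ≡ y
  to-injective = Injection.injective (↔⇒↣ card)

  from-injective : ∀ {i j} → from i ≡ from j → i ≡ j
  from-injective {i} {j} e = trans (sym (strictlyInverseˡ i)) (trans (cong to e) (strictlyInverseˡ j))

  infix 4 _≟_
  _≟_ : DecidableEquality Carrier
  _≟_ = via-injection (↔⇒↣ card) Fin._≟_

  1≢0 : 1# ≢ 0#
  1≢0 = ≢-sym 0≢1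

  infix 9 _⁻¹
  _⁻¹ : Carrier → Carrier
  x ⁻¹ with x ≟ 0#
  ... | yes _   = 0#
  ... | no x≢0 = proj₁ (inverse x x≢0)

  x*x⁻¹≡1 : ∀ {x} → x ≢ 0# → x * x ⁻¹ ≡ 1#
  x*x⁻¹≡1 {x} x≢0 with x ≟ 0#
  ... | yes x≡0 = ⊥-elim (x≢0 x≡0)
  ... | no x≢0′ = proj₂ (inverse x x≢0′)

  x⁻¹*x≡1 : ∀ {x} → x ≢ 0# → x ⁻¹ * x ≡ 1#
  x⁻¹*x≡1 {x} x≢0 = trans (*-comm (x ⁻¹) x) (x*x⁻¹≡1 x≢0)

  x⁻¹*[x*y]≡y : ∀ {x} y → x ≢ 0# → x ⁻¹ * (x * y) ≡ y
  x⁻¹*[x*y]≡y {x} y x≢0 = begin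
    x ⁻¹ * (x * y)  ≡⟨ *-assoc (x ⁻¹) x y ⟨
    x ⁻¹ * x * y    ≡⟨ cong (_* y) (x⁻¹*x≡1 x≢0) ⟩
    1# * y          ≡⟨ *-identityˡ y ⟩
    y               ∎
    where open ≡-Reasoning

  x*[x⁻¹*y]≡y : ∀ {x} y → x ≢ 0# → x * (x ⁻¹ * y) ≡ y
  x*[x⁻¹*y]≡y {x} y x≢0 = begin
    x * (x ⁻¹ * y)  ≡⟨ *-assoc x (x ⁻¹) y ⟨
    x * x ⁻¹ * y    ≡⟨ cong (_* y) (x*x⁻¹≡1 x≢0) ⟩
    1# * y          ≡⟨ *-identityˡ y ⟩
    y               ∎
    where open ≡-Reasoning

  x*y⁻¹*y≡x : ∀ x {y} → y ≢ 0# → x * y ⁻¹ * y ≡ x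
  x*y⁻¹*y≡x x {y} y≢0 = trans (*-assoc x (y ⁻¹) y) (trans (cong (x *_) (x⁻¹*x≡1 y≢0)) (*-identityʳ x))

  *-cancelˡ : ∀ {x y z} → x ≢ 0# → x * y ≡ x * z → y ≡ z
  *-cancelˡ {x} {y} {z} x≢0 e =
    trans (sym (x⁻¹*[x*y]≡y y x≢0)) (trans (cong (x ⁻¹ *_) e) (x⁻¹*[x*y]≡y z x≢0))

  x*y≡0⇒y≡0 : ∀ {x y} → x ≢ 0# → x * y ≡ 0# → y ≡ 0#
  x*y≡0⇒y≡0 {x} x≢0 e = *-cancelˡ x≢0 (trans e (sym (zeroʳ x)))

  x*y≢0 : ∀ {x y} → x ≢ 0# → y ≢ 0# → x * y ≢ 0#
  x*y≢0 x≢0 y≢0 e = y≢0 (x*y≡0⇒y≡0 x≢0 e)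

  x*y-y*x≡0 : ∀ x y → x * y + - (y * x) ≡ 0#
  x*y-y*x≡0 x y = trans (cong (λ e → x * y + - e) (*-comm y x)) (-‿inverseʳ (x * y))

  x+x≡[1+1]*x : ∀ x → x + x ≡ (1# + 1#) * x
  x+x≡[1+1]*x x = trans (cong₂ _+_ (sym (*-identityˡ x)) (sym (*-identityˡ x))) (sym (distribʳ x 1# 1#))

  y≡0⇒x*y≡0 : ∀ x {y} → y ≡ 0# → x * y ≡ 0#
  y≡0⇒x*y≡0 x y≡0 = trans (cong (x *_) y≡0) (zeroʳ x)

  x⁻¹≢0 : ∀ {x} → x ≢ 0# → x ⁻¹ ≢ 0#
  x⁻¹≢0 {x} x≢0 e = 1≢0 (trans (sym (x*x⁻¹≡1 x≢0)) (trans (cong (x *_) e) (zeroʳ x)))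

  two-valued⇒q≤2 : ∀ b → (∀ i → from i ≡ 0# ⊎ from i ≡ b) → q ≤ 2
  two-valued⇒q≤2 b two-valued = Fin.injective⇒≤ {f = class} class-injective
    where
    class : Fin q → Fin 2
    class i = [ (λ _ → 0F) , (λ _ → 1F) ]′ (two-valued i)
    class-injective : Injective _≡_ _≡_ class
    class-injective {i} {j} e with two-valued i | two-valued j
    ... | inj₁ i≡0 | inj₁ j≡0 = from-injective (trans i≡0 (sym j≡0))
    ... | inj₂ i≡b | inj₂ j≡b = from-injective (trans i≡b (sym j≡b))
    ... | inj₁ _   | inj₂ _   = ⊥-elim (Fin.0≢1+n e)
    ... | inj₂ _   | inj₁ _   = ⊥-elim (Fin.0≢1+n (sym e))

  third-element : ∀ b → 2 ℕ.< q → ∃[ t ] (t ≢ 0# × t ≢ b)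
  third-element b 2<q = from i , (λ e → ¬two-valuedᵢ (inj₁ e)) , (λ e → ¬two-valuedᵢ (inj₂ e))
    where
    found = Fin.¬∀⟶∃¬ q (λ i → from i ≡ 0# ⊎ from i ≡ b) (λ i → (from i ≟ 0#) ⊎-dec (from i ≟ b))
                      (λ two-valued → ℕ.<⇒≱ 2<q (two-valued⇒q≤2 b two-valued))
    i = proj₁ found
    ¬two-valuedᵢ = proj₂ found

  ∑≡sum : ∀ {m} (f : Fin m → Carrier) → ∑ F f ≡ sum f
  ∑≡sum {zero}  f = refl
  ∑≡sum {suc m} f = cong (f zero +_) (∑≡sum (f ∘ suc))

  ∑-cong : ∀ {m} {f g : Fin m → Carrier} → (∀ i → f i ≡ g i) → ∑ F f ≡ ∑ F g
  ∑-cong {f = f} {g} f≗g = trans (∑≡sum f) (trans (sum-cong-≗ f≗g) (sym (∑≡sum g)))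

  ∑-distrib-+ : ∀ {m} (f g : Fin m → Carrier) → ∑ F (λ i → f i + g i) ≡ ∑ F f + ∑ F g
  ∑-distrib-+ f g =
    trans (∑≡sum (λ i → f i + g i)) (trans (sum-distrib-+ f g) (sym (cong₂ _+_ (∑≡sum f) (∑≡sum g))))

  *-distribˡ-∑ : ∀ {m} x (f : Fin m → Carrier) → ∑ F (λ i → x * f i) ≡ x * ∑ F f
  *-distribˡ-∑ x f = trans (∑≡sum (λ i → x * f i)) (sym (trans (cong (x *_) (∑≡sum f)) (*-distribˡ-sum x f)))

  ∑-zero : ∀ {m} → ∑ F {m} (λ _ → 0#) ≡ 0#
  ∑-zero {m} = trans (∑≡sum (λ (_ : Fin m) → 0#)) (sum-replicate-zero m)

  ∑-removeAt : ∀ {m} (f : Fin (suc m) → Carrier) i → ∑ F f ≡ f i + ∑ F (removeAt f i)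
  ∑-removeAt f i = trans (∑≡sum f) (trans (sum-remove f) (cong (f i +_) (sym (∑≡sum (removeAt f i)))))

  infix 8 _∙_
  _∙_ : ∀ {m} → Vec F m → Vec F m → Carrier
  u ∙ v = ∑ F (λ i → u i * v i)

  ∙-cong : ∀ {m} {u u′ v v′ : Vec F m} → u ≈ u′ → v ≈ v′ → u ∙ v ≡ u′ ∙ v′
  ∙-cong u≈u′ v≈v′ = ∑-cong (λ i → cong₂ _*_ (u≈u′ i) (v≈v′ i))

  ∙-congˡ : ∀ {m} {u u′ : Vec F m} → u ≈ u′ → ∀ v → u ∙ v ≡ u′ ∙ v
  ∙-congˡ u≈u′ v = ∙-cong {v = v} u≈u′ (λ _ → refl)

  ∙-congʳ : ∀ {m} (u : Vec F m) {v v′} → v ≈ v′ → u ∙ v ≡ u ∙ v′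
  ∙-congʳ u = ∙-cong {u = u} (λ _ → refl)

  ∙-distribˡ-+ : ∀ {m} (u v w : Vec F m) → u ∙ (λ i → v i + w i) ≡ u ∙ v + u ∙ w
  ∙-distribˡ-+ u v w =
    trans (∑-cong (λ i → distribˡ (u i) (v i) (w i))) (∑-distrib-+ (λ i → u i * v i) (λ i → u i * w i))

  ∙-distribʳ-+ : ∀ {m} (u v w : Vec F m) → (λ i → u i + v i) ∙ w ≡ u ∙ w + v ∙ w
  ∙-distribʳ-+ u v w =
    trans (∑-cong (λ i → distribʳ (w i) (u i) (v i))) (∑-distrib-+ (λ i → u i * w i) (λ i → v i * w i))

  ∙-·ʳ : ∀ {m} (u v : Vec F m) a → u ∙ (a · v) ≡ a * (u ∙ v)
  ∙-·ʳ u v a = trans (∑-cong (λ i → x*[y*z]≡y*[x*z] (u i) a (v i))) (*-distribˡ-∑ a (λ i → u i * v i))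

  ∙-·ˡ : ∀ {m} (u v : Vec F m) a → (a · u) ∙ v ≡ a * (u ∙ v)
  ∙-·ˡ u v a = trans (∑-cong (λ i → *-assoc a (u i) (v i))) (*-distribˡ-∑ a (λ i → u i * v i))

  ∙-negʳ : ∀ {m} (u v : Vec F m) → u ∙ (λ i → - v i) ≡ - (u ∙ v)
  ∙-negʳ u v = trans (∙-congʳ u (λ i → sym (-1*x≈-x (v i)))) (trans (∙-·ʳ u v (- 1#)) (-1*x≈-x (u ∙ v)))

  ∙-negˡ : ∀ {m} (u v : Vec F m) → (λ i → - u i) ∙ v ≡ - (u ∙ v)
  ∙-negˡ u v = trans (∙-congˡ (λ i → sym (-1*x≈-x (u i))) v) (trans (∙-·ˡ u v (- 1#)) (-1*x≈-x (u ∙ v)))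

  ∙-zeroʳ : ∀ {m} (u : Vec F m) → u ∙ 0ᵥ ≡ 0#
  ∙-zeroʳ {m} u = trans (∑-cong (λ i → zeroʳ (u i))) (∑-zero {m})

  ∙-zeroˡ : ∀ {m} (u : Vec F m) → 0ᵥ ∙ u ≡ 0#
  ∙-zeroˡ {m} u = trans (∑-cong (λ i → zeroˡ (u i))) (∑-zero {m})

  ∙-removeAt : ∀ {m} (u v : Vec F (suc m)) i → u ∙ v ≡ u i * v i + removeAt u i ∙ removeAt v i
  ∙-removeAt u v = ∑-removeAt (λ i → u i * v i)

  infixl 6 _[_]≔_
  _[_]≔_ : ∀ {m} → Vec F m → Fin m → Carrier → Vec F m
  v [ i ]≔ c = updateAt v i (λ _ → c)

  []≔-updates : ∀ {m} (v : Vec F m) i {c} → (v [ i ]≔ c) i ≡ c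
  []≔-updates v i = updateAt-updates i v

  []≔-minimal : ∀ {m} (v : Vec F m) {i j} {c} → j ≢ i → (v [ i ]≔ c) j ≡ v j
  []≔-minimal v {i} {j} = updateAt-minimal j i v

  []≔-idem : ∀ {m} {v : Vec F m} {i c} → c ≡ v i → v [ i ]≔ c ≈ v
  []≔-idem {v = v} {i} c≡vᵢ j with j Fin.≟ i
  ... | yes refl = trans ([]≔-updates v j) c≡vᵢ
  ... | no j≢i   = []≔-minimal v j≢i

  []≔-preserves : ∀ {m} (P : Carrier → Set) {v : Vec F m} {i c} → (∀ j → P (v j)) → P c → ∀ j → P ((v [ i ]≔ c) j)
  []≔-preserves P {v} {i} Pv Pc j with j Fin.≟ i
  ... | yes refl = subst P (sym ([]≔-updates v j)) Pc
  ... | no j≢i   = subst P (sym ([]≔-minimal v j≢i)) (Pv j)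

  unit : ∀ {m} → Fin m → Vec F m
  unit i = 0ᵥ [ i ]≔ 1#

  ∙-unit : ∀ {m} (u : Vec F (suc m)) i → u ∙ unit i ≡ u i
  ∙-unit u i = begin
    u ∙ unit i                                        ≡⟨ ∙-removeAt u (unit i) i ⟩
    u i * unit i i + removeAt u i ∙ removeAt (unit i) i
      ≡⟨ cong₂ (λ a b → u i * a + b) ([]≔-updates 0ᵥ i)
               (trans (∙-congʳ (removeAt u i) (λ j → []≔-minimal 0ᵥ (Fin.punchInᵢ≢i i j)))
                      (∙-zeroʳ (removeAt u i))) ⟩
    u i * 1# + 0#                                     ≡⟨ +-identityʳ _ ⟩
    u i * 1#                                          ≡⟨ *-identityʳ (u i) ⟩
    u i                                               ∎
    where open ≡-Reasoning

  encode : ∀ {d} → Vec F d → Fin (q ^ d)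
  encode v = funToFin (to ∘ v)

  encode-injective : ∀ {d} (u v : Vec F d) → encode u ≡ encode v → u ≈ v
  encode-injective u v e i = to-injective (begin
    to (u i)               ≡⟨ Fin.finToFun-funToFin (to ∘ u) i ⟨
    finToFun (encode u) i  ≡⟨ cong (λ c → finToFun c i) e ⟩
    finToFun (encode v) i  ≡⟨ Fin.finToFun-funToFin (to ∘ v) i ⟩
    to (v i)               ∎)
    where open ≡-Reasoning

  decode : ∀ {d} → Fin (q ^ d) → Vec F d
  decode {d} c = from ∘ finToFun {q} {d} c

  decode-injective : ∀ {d} (c c′ : Fin (q ^ d)) → decode c ≈ decode c′ → c ≡ c′
  decode-injective {d} c c′ e = begin
    c                                   ≡⟨ Fin.funToFin-finToFin {d} {q} c ⟨
    funToFin (finToFun {q} {d} c)       ≡⟨ funToFin-cong {d} (λ i → from-injective (e i)) ⟩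
    funToFin (finToFun {q} {d} c′)      ≡⟨ Fin.funToFin-finToFin {d} {q} c′ ⟩
    c′                                  ∎
    where open ≡-Reasoning

  Vec-injection⇒≤ : ∀ {d m} (f : Vec F d → Fin m) → (∀ u v → f u ≡ f v → u ≈ v) → q ^ d ≤ m
  Vec-injection⇒≤ {d} f f-inj = Fin.injective⇒≤ {f = f ∘ decode {d}} (λ e → decode-injective {d} _ _ (f-inj _ _ e))

  -- The canonical representative of the line through a non-zero vector: its first non-zero
  -- coordinate is scaled to 1.
  projectivePoint : ∀ {d} (v : Vec F d) → ¬ v ≈ 0ᵥ → Fin ([ d ] q)
  projectivePoint {zero}  v v≉0 = ⊥-elim (v≉0 (λ ()))
  projectivePoint {suc d} v v≉0 with v zero ≟ 0#
  ... | no _     = encode (v zero ⁻¹ · (v ∘ suc)) ↑ˡ [ d ] q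
  ... | yes v₀≡0 = q ^ d ↑ʳ projectivePoint (v ∘ suc) (λ v′≈0 → v≉0 λ { zero → v₀≡0 ; (suc j) → v′≈0 j })

  projectivePoint-injective : ∀ {d} (u v : Vec F d) u≉0 v≉0 →
    projectivePoint u u≉0 ≡ projectivePoint v v≉0 → ∃[ μ ] (u ≈ μ · v)
  projectivePoint-injective {zero}  u v u≉0 v≉0 e = ⊥-elim (u≉0 (λ ()))
  projectivePoint-injective {suc d} u v u≉0 v≉0 e with u zero ≟ 0# | v zero ≟ 0#
  ... | no u₀≢0 | no v₀≢0 = u zero * v zero ⁻¹ , λ where
        zero    → sym (x*y⁻¹*y≡x (u zero) v₀≢0)
        (suc j) → begin
          u (suc j)                              ≡⟨ x*[x⁻¹*y]≡y (u (suc j)) u₀≢0 ⟨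
          u zero * (u zero ⁻¹ * u (suc j))       ≡⟨ cong (u zero *_) (same-direction j) ⟩
          u zero * (v zero ⁻¹ * v (suc j))       ≡⟨ *-assoc _ _ _ ⟨
          u zero * v zero ⁻¹ * v (suc j)         ∎
    where
    open ≡-Reasoning
    same-direction : u zero ⁻¹ · (u ∘ suc) ≈ v zero ⁻¹ · (v ∘ suc)
    same-direction = encode-injective _ _ (Fin.↑ˡ-injective _ _ _ e)
  ... | no _     | yes _    = ⊥-elim (↑ˡ≢↑ʳ _ _ e)
  ... | yes _    | no _     = ⊥-elim (↑ˡ≢↑ʳ _ _ (sym e))
  ... | yes u₀≡0 | yes v₀≡0
    with μ , u′≈μv′ ← projectivePoint-injective (u ∘ suc) (v ∘ suc) _ _ (Fin.↑ʳ-injective _ _ _ e)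
    = μ , λ where
        zero    → trans u₀≡0 (sym (trans (cong (μ *_) v₀≡0) (zeroʳ μ)))
        (suc j) → u′≈μv′ j

  ColumnsProjective : ∀ {k n} → Mat F k n → Set
  ColumnsProjective G = (∀ j → ¬ column F G j ≈ 0ᵥ)
                      × (∀ j j′ → j ≢ j′ → ∀ λ′ → ¬ column F G j ≈ λ′ · column F G j′)

  unit-nonzero : ∀ {m} (i : Fin m) → ¬ unit i ≈ 0ᵥ
  unit-nonzero i e = 1≢0 (trans (sym ([]≔-updates 0ᵥ i)) (e i))

  module Columns {k} {G : Mat F (suc k) ([ suc k ] q)} (G-projective : ColumnsProjective G) where

    column-nonzero : ∀ l → ¬ column F G l ≈ 0ᵥ
    column-nonzero = proj₁ G-projective

    proportional⇒≡ : ∀ {l l′} μ → column F G l ≈ μ · column F G l′ → l ≡ l′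
    proportional⇒≡ {l} {l′} μ e with l Fin.≟ l′
    ... | yes l≡l′ = l≡l′
    ... | no l≢l′ = ⊥-elim (proj₂ G-projective l l′ l≢l′ μ e)

    columnPoint : Fin ([ suc k ] q) → Fin ([ suc k ] q)
    columnPoint l = projectivePoint (column F G l) (column-nonzero l)

    columnPoint-injective : Injective _≡_ _≡_ columnPoint
    columnPoint-injective e = proportional⇒≡ _ (proj₂ (projectivePoint-injective _ _ _ _ e))

    columns-cover : ∀ g → ¬ g ≈ 0ᵥ → ∃[ l ] ∃[ μ ] (g ≈ μ · column F G l)
    columns-cover g g≉0
      with l , hit ← injective⇒surjective columnPoint columnPoint-injective (projectivePoint g g≉0)
      = l , projectivePoint-injective g (column F G l) g≉0 (column-nonzero l) (sym hit)

    rowsIndependent : RowsIndependent F G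
    rowsIndependent c c·G≈0 i with l , μ , eᵢ≈μGₗ ← columns-cover (unit i) (unit-nonzero i) = begin
      c i                     ≡⟨ ∙-unit c i ⟨
      c ∙ unit i              ≡⟨ ∙-congʳ c eᵢ≈μGₗ ⟩
      c ∙ (μ · column F G l)  ≡⟨ ∙-·ʳ c (column F G l) μ ⟩
      μ * combo F G c l       ≡⟨ cong (μ *_) (c·G≈0 l) ⟩
      μ * 0#                  ≡⟨ zeroʳ μ ⟩
      0#                      ∎
      where open ≡-Reasoning

    isSimplexGenerator : IsSimplexGenerator F (suc k) G
    isSimplexGenerator = rowsIndependent , G-projective

    -- The vectors g with h ∙ g ≡ 1 form an affine hyperplane of size q ^ k, and no two of them
    -- are proportional; so they lie on q ^ k distinct columns, all in the support of h ∙ G.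
    support-≥ : ∀ (h : Vec F (suc k)) i → h i ≢ 0# → ∀ {m} (S : Fin m → Fin ([ suc k ] q)) →
                (∀ l → combo F G h l ≢ 0# → ∃[ t ] (S t ≡ l)) → q ^ k ≤ m
    support-≥ h i hᵢ≢0 S S-covers = Vec-injection⇒≤ position position-injective
      where
      lift : Vec F k → Vec F (suc k)
      lift u = insertAt u i (h i ⁻¹ * (1# + - (removeAt h i ∙ u)))

      h∙lift≡1 : ∀ u → h ∙ lift u ≡ 1#
      h∙lift≡1 u = begin
        h ∙ lift u                                          ≡⟨ ∙-removeAt h (lift u) i ⟩
        h i * lift u i + removeAt h i ∙ removeAt (lift u) i
          ≡⟨ cong₂ (λ a b → h i * a + b) (insertAt-lookup u i _)
                   (∙-congʳ (removeAt h i) (removeAt-insertAt u i _)) ⟩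
        h i * (h i ⁻¹ * (1# + - r)) + r                      ≡⟨ cong (_+ r) (x*[x⁻¹*y]≡y _ hᵢ≢0) ⟩
        1# + - r + r                                        ≡⟨ +-assoc 1# (- r) r ⟩
        1# + (- r + r)                                      ≡⟨ cong (1# +_) (-‿inverseˡ r) ⟩
        1# + 0#                                             ≡⟨ +-identityʳ 1# ⟩
        1#                                                  ∎
        where
        open ≡-Reasoning
        r = removeAt h i ∙ u

      lift≉0 : ∀ u → ¬ lift u ≈ 0ᵥ
      lift≉0 u e = 1≢0 (trans (sym (h∙lift≡1 u)) (trans (∙-congʳ h e) (∙-zeroʳ h)))

      μ*combo≡1 : ∀ {u μ l} → lift u ≈ μ · column F G l → μ * combo F G h l ≡ 1#
      μ*combo≡1 {u} {μ} {l} e = trans (sym (trans (∙-congʳ h e) (∙-·ʳ h (column F G l) μ))) (h∙lift≡1 u)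

      combo≢0 : ∀ {u μ l} → lift u ≈ μ · column F G l → combo F G h l ≢ 0#
      combo≢0 {μ = μ} e hGₗ≡0 = 1≢0 (trans (sym (μ*combo≡1 e)) (trans (cong (μ *_) hGₗ≡0) (zeroʳ μ)))

      hit : ∀ u → ∃[ t ] ∃[ μ ] (lift u ≈ μ · column F G (S t))
      hit u with l , μ , e ← columns-cover (lift u) (lift≉0 u)
            with t , refl ← S-covers l (combo≢0 e) = t , μ , e

      position : Vec F k → Fin _
      position u = proj₁ (hit u)

      same-column⇒≈ : ∀ {u u′ μ μ′ l} → lift u ≈ μ · column F G l → lift u′ ≈ μ′ · column F G l → u ≈ u′
      same-column⇒≈ {u} {u′} {μ} {μ′} {l} e e′ j = begin
        u j                              ≡⟨ removeAt-insertAt u i _ j ⟨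
        lift u (punchIn i j)             ≡⟨ e (punchIn i j) ⟩
        μ * G (punchIn i j) l            ≡⟨ cong (λ ν → ν * G (punchIn i j) l) μ≡μ′ ⟩
        μ′ * G (punchIn i j) l           ≡⟨ e′ (punchIn i j) ⟨
        lift u′ (punchIn i j)            ≡⟨ removeAt-insertAt u′ i _ j ⟩
        u′ j                             ∎
        where
        open ≡-Reasoning
        μ≡μ′ : μ ≡ μ′
        μ≡μ′ = *-cancelˡ (combo≢0 e)
          (trans (*-comm _ μ) (trans (μ*combo≡1 e) (sym (trans (*-comm _ μ′) (μ*combo≡1 e′)))))

      position-injective : ∀ u u′ → position u ≡ position u′ → u ≈ u′
      position-injective u u′ eq = same-column⇒≈ (proj₂ (proj₂ (hit u)))
        (subst (λ t → lift u′ ≈ proj₁ (proj₂ (hit u′)) · column F G (S t)) (sym eq) (proj₂ (proj₂ (hit u′))))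

    distance-≥ : ∀ {z w} → InCode F G z → InCode F G w → ∀ {l₀} → z l₀ ≢ w l₀ →
                 ∀ {m} (S : Fin m → Fin ([ suc k ] q)) → (∀ l → (∀ t → S t ≢ l) → z l ≡ w l) → q ^ k ≤ m
    distance-≥ {z} {w} (c , c·G≈z) (c′ , c′·G≈w) {l₀} z≢w S z≡w-off-S =
      support-≥ h (proj₁ h-nonzero-at) (proj₂ h-nonzero-at) S S-covers
      where
      h : Vec F (suc k)
      h i = c i + - c′ i

      h·G≡z-w : ∀ l → combo F G h l ≡ z l + - w l
      h·G≡z-w l = begin
        combo F G h l                                 ≡⟨ ∙-distribʳ-+ c (λ i → - c′ i) (column F G l) ⟩
        combo F G c l + (λ i → - c′ i) ∙ column F G l ≡⟨ cong (combo F G c l +_) (∙-negˡ c′ (column F G l)) ⟩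
        combo F G c l + - combo F G c′ l              ≡⟨ cong₂ (λ a b → a + - b) (c·G≈z l) (c′·G≈w l) ⟩
        z l + - w l                                   ∎
        where open ≡-Reasoning

      h≉0 : ¬ (∀ i → h i ≡ 0#)
      h≉0 h≈0 = z≢w (x∙y⁻¹≈ε⇒x≈y (z l₀) (w l₀)
        (trans (sym (h·G≡z-w l₀)) (trans (∙-congˡ h≈0 (column F G l₀)) (∙-zeroˡ (column F G l₀)))))

      h-nonzero-at : ∃[ i ] (h i ≢ 0#)
      h-nonzero-at = Fin.¬∀⟶∃¬ _ (λ i → h i ≡ 0#) (λ i → h i ≟ 0#) h≉0

      S-covers : ∀ l → combo F G h l ≢ 0# → ∃[ t ] (S t ≡ l)
      S-covers l hGₗ≢0 with Fin.any? (λ t → S t Fin.≟ l)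
      ... | yes hit = hit
      ... | no miss = ⊥-elim (hGₗ≢0 (trans (h·G≡z-w l)
                        (trans (cong (_+ - w l) (z≡w-off-S l (λ t e → miss (t , e)))) (-‿inverseʳ (w l)))))

  monomial : ∀ {k n} → Mat F k n → (Fin n → Fin n) → (Fin n → Carrier) → Mat F k n
  monomial G σ α i l = α l * G i (σ l)

  combo-monomial : ∀ {k n} (G : Mat F k n) σ α c l → combo F (monomial G σ α) c l ≡ α l * combo F G c (σ l)
  combo-monomial G σ α c l = ∙-·ʳ c (column F G (σ l)) (α l)

  monomial-projective : ∀ {k n} {G : Mat F k n} {σ α} → ColumnsProjective G → Injective _≡_ _≡_ σ →
                        (∀ l → α l ≢ 0#) → ColumnsProjective (monomial G σ α)
  monomial-projective {G = G} {σ} {α} (G-nonzero , G-nonproportional) σ-injective α≢0 =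
    (λ l Gₗ≈0 → G-nonzero (σ l) (λ i → x*y≡0⇒y≡0 (α≢0 l) (Gₗ≈0 i))) ,
    λ l l′ l≢l′ μ Gₗ≈μGₗ′ → G-nonproportional (σ l) (σ l′) (l≢l′ ∘ σ-injective)
      (α l ⁻¹ * (μ * α l′)) (λ i → begin
        G i (σ l)                          ≡⟨ x⁻¹*[x*y]≡y _ (α≢0 l) ⟨
        α l ⁻¹ * (α l * G i (σ l))         ≡⟨ cong (α l ⁻¹ *_) (Gₗ≈μGₗ′ i) ⟩
        α l ⁻¹ * (μ * (α l′ * G i (σ l′))) ≡⟨ cong (α l ⁻¹ *_) (*-assoc μ (α l′) _) ⟨
        α l ⁻¹ * (μ * α l′ * G i (σ l′))   ≡⟨ *-assoc (α l ⁻¹) _ _ ⟨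
        α l ⁻¹ * (μ * α l′) * G i (σ l′)   ∎)
    where open ≡-Reasoning

  InSomeSimplex-cong : ∀ {k} {u u′ v v′ : Vec F ([ k ] q)} → u ≈ u′ → v ≈ v′ →
                       InSomeSimplex F k u v → InSomeSimplex F k u′ v′
  InSomeSimplex-cong u≈u′ v≈v′ (G , G-simplex , (c , c·G≈u) , (d , d·G≈v)) =
    G , G-simplex , (c , λ l → trans (c·G≈u l) (u≈u′ l)) , (d , λ l → trans (d·G≈v l) (v≈v′ l))

  InSomeSimplex-monomial : ∀ {k u v} σ α → Injective _≡_ _≡_ σ → (∀ l → α l ≢ 0#) →
    InSomeSimplex F (suc k) u v → InSomeSimplex F (suc k) (λ l → α l * u (σ l)) (λ l → α l * v (σ l))
  InSomeSimplex-monomial σ α σ-injective α≢0 (G , (_ , G-projective) , (c , c·G≈u) , (d , d·G≈v)) =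
    monomial G σ α , Columns.isSimplexGenerator (monomial-projective G-projective σ-injective α≢0) ,
    (c , λ l → trans (combo-monomial G σ α c l) (cong (α l *_) (c·G≈u (σ l)))) ,
    (d , λ l → trans (combo-monomial G σ α d l) (cong (α l *_) (d·G≈v (σ l))))

  swap-step : ∀ {k u v} {L L′ : Fin ([ suc k ] q)} {s s′} → L ≢ L′ → s ≢ 0# → s′ ≢ 0# →
              s * u L′ ≡ u L → s′ * u L ≡ u L′ →
              InSomeSimplex F (suc k) u v → InSomeSimplex F (suc k) u (v [ L ]≔ s * v L′ [ L′ ]≔ s′ * v L)
  swap-step {k} {u} {v} {L} {L′} {s} {s′} L≢L′ s≢0 s′≢0 su≡u s′u≡u u∼v =
    InSomeSimplex-cong u-fixed (swapped v)
      (InSomeSimplex-monomial (transpose L L′) α (transpose-injective L L′) α≢0 u∼v)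
    where
    α : Vec F ([ suc k ] q)
    α = (λ _ → 1#) [ L ]≔ s [ L′ ]≔ s′

    α≢0 : ∀ l → α l ≢ 0#
    α≢0 = []≔-preserves (_≢ 0#) ([]≔-preserves (_≢ 0#) (λ _ → 1≢0) s≢0) s′≢0

    swapped : ∀ t l → α l * t (transpose L L′ l) ≡ (t [ L ]≔ s * t L′ [ L′ ]≔ s′ * t L) l
    swapped t = by-positions (λ l → α l * t (transpose L L′ l) ≡ (t [ L ]≔ s * t L′ [ L′ ]≔ s′ * t L) l)
      (L ∷ L′ ∷ [])
      (λ where
        0F → trans (cong₂ (λ a j → a * t j) (trans ([]≔-minimal _ L≢L′) ([]≔-updates _ L)) (transpose-matchˡ L L′))
                   (sym (trans ([]≔-minimal _ L≢L′) ([]≔-updates _ L)))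
        1F → trans (cong₂ (λ a j → a * t j) ([]≔-updates _ L′) (transpose-matchʳ L L′)) (sym ([]≔-updates _ L′)))
      λ l off → let l≢L = ≢-sym (off 0F) ; l≢L′ = ≢-sym (off 1F) in
        trans (cong₂ (λ a j → a * t j) (trans ([]≔-minimal _ l≢L′) ([]≔-minimal _ l≢L)) (transpose-other l≢L l≢L′))
              (trans (*-identityˡ (t l)) (sym (trans ([]≔-minimal _ l≢L′) ([]≔-minimal _ l≢L))))

    u-fixed : ∀ l → α l * u (transpose L L′ l) ≡ u l
    u-fixed l = trans (swapped u l) (trans ([]≔-idem (trans s′u≡u (sym ([]≔-minimal u (≢-sym L≢L′)))) l)
                                           ([]≔-idem su≡u l))

  rescale-step : ∀ {k u v} {L : Fin ([ suc k ] q)} {c} → u L ≡ 0# → v L ≢ 0# → c ≢ 0# →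
                 InSomeSimplex F (suc k) u v → InSomeSimplex F (suc k) u (v [ L ]≔ c)
  rescale-step {k} {u} {v} {L} {c} uL≡0 vL≢0 c≢0 u∼v =
    InSomeSimplex-cong u-fixed rescaled (InSomeSimplex-monomial id α id α≢0 u∼v)
    where
    α : Vec F ([ suc k ] q)
    α = (λ _ → 1#) [ L ]≔ c * v L ⁻¹

    α≢0 : ∀ l → α l ≢ 0#
    α≢0 = []≔-preserves (_≢ 0#) (λ _ → 1≢0) (x*y≢0 c≢0 (x⁻¹≢0 vL≢0))

    u-fixed : ∀ l → α l * u l ≡ u l
    u-fixed l with l Fin.≟ L
    ... | yes refl = trans (cong (α l *_) uL≡0) (trans (zeroʳ (α l)) (sym uL≡0))
    ... | no l≢L   = trans (cong (_* u l) ([]≔-minimal _ l≢L)) (*-identityˡ (u l))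

    rescaled : ∀ l → α l * v l ≡ (v [ L ]≔ c) l
    rescaled l with l Fin.≟ L
    ... | yes refl = trans (cong (_* v l) ([]≔-updates _ l)) (trans (x*y⁻¹*y≡x c vL≢0) (sym ([]≔-updates v l)))
    ... | no l≢L   = trans (cong (_* v l) ([]≔-minimal _ l≢L)) (trans (*-identityˡ (v l)) (sym ([]≔-minimal v l≢L)))

  exchange : ∀ {n} → Vec F n → Fin n → Fin n → Vec F n → Vec F n
  exchange u L L′ v = v [ L ]≔ u L * u L′ ⁻¹ * v L′ [ L′ ]≔ u L′ * u L ⁻¹ * v L

  exchange-left : ∀ {n} u {L L′ : Fin n} v → L ≢ L′ → exchange u L L′ v L ≡ u L * u L′ ⁻¹ * v L′
  exchange-left u {L} v L≢L′ = trans ([]≔-minimal _ L≢L′) ([]≔-updates v L)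

  exchange-right : ∀ {n} u {L L′ : Fin n} v → exchange u L L′ v L′ ≡ u L′ * u L ⁻¹ * v L
  exchange-right u {L} {L′} v = []≔-updates (v [ L ]≔ u L * u L′ ⁻¹ * v L′) L′

  exchange-elsewhere : ∀ {n} u {L L′ l : Fin n} v → l ≢ L → l ≢ L′ → exchange u L L′ v l ≡ v l
  exchange-elsewhere u v l≢L l≢L′ = trans ([]≔-minimal _ l≢L′) ([]≔-minimal v l≢L)

  exchange-step : ∀ {k u v} {L L′ : Fin ([ suc k ] q)} → L ≢ L′ → u L ≢ 0# → u L′ ≢ 0# →
                  InSomeSimplex F (suc k) u v → InSomeSimplex F (suc k) u (exchange u L L′ v)
  exchange-step {u = u} {L = L} {L′} L≢L′ uL≢0 uL′≢0 = swap-step L≢L′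
    (x*y≢0 uL≢0 (x⁻¹≢0 uL′≢0)) (x*y≢0 uL′≢0 (x⁻¹≢0 uL≢0))
    (x*y⁻¹*y≡x (u L) uL′≢0) (x*y⁻¹*y≡x (u L′) uL≢0)

  close⇒¬InSomeSimplex : ∀ {k m} {z w : Vec F ([ suc k ] q)} → m ℕ.< q ^ k → (S : Fin m → Fin ([ suc k ] q)) →
    (∀ l → (∀ t → S t ≢ l) → z l ≡ w l) → ∀ {l₀} → z l₀ ≢ w l₀ → ¬ InSomeSimplex F (suc k) z w
  close⇒¬InSomeSimplex m<q^k S z≡w-off-S z≢w (H , (_ , H-projective) , z∈H , w∈H) =
    ℕ.<⇒≱ m<q^k (Columns.distance-≥ H-projective z∈H w∈H z≢w S z≡w-off-S)

  module Frame {k} {G : Mat F (suc k) ([ suc k ] q)} (G-simplex : IsSimplexGenerator F (suc k) G)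
               {x y : Vec F ([ suc k ] q)} {c d : Vec F (suc k)}
               (c·G≈x : combo F G c ≈ x) (d·G≈y : combo F G d ≈ y) (independent : LinIndep₂ F x y) where

    open Columns (proj₂ G-simplex)

    minor : Fin ([ suc k ] q) → Fin ([ suc k ] q) → Carrier
    minor p r = x p * y r + - (x r * y p)

    nonzero-minor : ∃[ p ] ∃[ r ] (minor p r ≢ 0#)
    nonzero-minor = p , Fin.¬∀⟶∃¬ _ (λ r → minor p r ≡ 0#) (λ r → minor p r ≟ 0#) y∦x
      where
      x-nonzero-at : ∃[ p ] (x p ≢ 0#)
      x-nonzero-at = Fin.¬∀⟶∃¬ _ (λ p → x p ≡ 0#) (λ p → x p ≟ 0#) λ x≈0 →
        1≢0 (proj₁ (independent 1# 0# λ j → trans (cong₂ _+_ (*-identityˡ (x j)) (zeroˡ (y j)))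
                                                 (trans (+-identityʳ (x j)) (x≈0 j))))
      p = proj₁ x-nonzero-at
      y∦x : ¬ (∀ r → minor p r ≡ 0#)
      y∦x minor≡0 = proj₂ x-nonzero-at (proj₂ (independent (- y p) (x p) λ j → begin
        - y p * x j + x p * y j      ≡⟨ cong (_+ x p * y j) (-‿distribˡ-* (y p) (x j)) ⟨
        - (y p * x j) + x p * y j    ≡⟨ cong (λ a → - a + x p * y j) (*-comm (y p) (x j)) ⟩
        - (x j * y p) + x p * y j    ≡⟨ +-comm _ _ ⟩
        minor p j                    ≡⟨ minor≡0 j ⟩
        0#                           ∎))
        where open ≡-Reasoning

    p r : Fin ([ suc k ] q)
    p = proj₁ nonzero-minor
    r = proj₁ (proj₂ nonzero-minor)

    D : Carrier
    D = minor p r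

    D≢0 : D ≢ 0#
    D≢0 = proj₂ (proj₂ nonzero-minor)

    -- Cramer's rule for the 2×2 system given by the columns p and r
    cramer : Carrier → Fin ([ suc k ] q) → Carrier → Fin ([ suc k ] q) → Vec F (suc k)
    cramer a l b l′ i = D ⁻¹ * (a * G i l + - (b * G i l′))

    ∙-cramer : ∀ u {f} → combo F G u ≈ f → ∀ a l b l′ → u ∙ cramer a l b l′ ≡ D ⁻¹ * (a * f l + - (b * f l′))
    ∙-cramer u {f} u·G≈f a l b l′ = begin
      u ∙ cramer a l b l′
        ≡⟨ ∙-·ʳ u (λ i → a * G i l + - (b * G i l′)) (D ⁻¹) ⟩
      D ⁻¹ * u ∙ (λ i → a * G i l + - (b * G i l′))
        ≡⟨ cong (D ⁻¹ *_) (∙-distribˡ-+ u (a · column F G l) (λ i → - (b * G i l′))) ⟩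
      D ⁻¹ * (u ∙ (a · column F G l) + u ∙ (λ i → - (b * G i l′)))
        ≡⟨ cong₂ (λ e e′ → D ⁻¹ * (e + e′)) (∙-·ʳ u (column F G l) a)
                 (trans (∙-negʳ u (b · column F G l′)) (cong -_ (∙-·ʳ u (column F G l′) b))) ⟩
      D ⁻¹ * (a * combo F G u l + - (b * combo F G u l′))
        ≡⟨ cong₂ (λ e e′ → D ⁻¹ * (a * e + - (b * e′))) (u·G≈f l) (u·G≈f l′) ⟩
      D ⁻¹ * (a * f l + - (b * f l′))
        ∎
      where open ≡-Reasoning

    g₁ g₂ : Vec F (suc k)
    g₁ = cramer (y r) p (y p) r
    g₂ = cramer (x p) r (x r) p

    c∙g₁≡1 : c ∙ g₁ ≡ 1#
    c∙g₁≡1 = trans (∙-cramer c c·G≈x (y r) p (y p) r)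
      (trans (cong₂ (λ e e′ → D ⁻¹ * (e + - e′)) (*-comm (y r) (x p)) (*-comm (y p) (x r))) (x⁻¹*x≡1 D≢0))

    d∙g₁≡0 : d ∙ g₁ ≡ 0#
    d∙g₁≡0 = trans (∙-cramer d d·G≈y (y r) p (y p) r) (y≡0⇒x*y≡0 (D ⁻¹) (x*y-y*x≡0 (y r) (y p)))

    c∙g₂≡0 : c ∙ g₂ ≡ 0#
    c∙g₂≡0 = trans (∙-cramer c c·G≈x (x p) r (x r) p) (y≡0⇒x*y≡0 (D ⁻¹) (x*y-y*x≡0 (x p) (x r)))

    d∙g₂≡1 : d ∙ g₂ ≡ 1#
    d∙g₂≡1 = trans (∙-cramer d d·G≈y (x p) r (x r) p) (x⁻¹*x≡1 D≢0)

    preimage : Carrier → Carrier → Vec F (suc k)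
    preimage s t i = s * g₁ i + t * g₂ i

    ∙-preimage : ∀ u s t → u ∙ preimage s t ≡ s * u ∙ g₁ + t * u ∙ g₂
    ∙-preimage u s t = trans (∙-distribˡ-+ u (s · g₁) (t · g₂)) (cong₂ _+_ (∙-·ʳ u g₁ s) (∙-·ʳ u g₂ t))

    c∙preimage : ∀ s t → c ∙ preimage s t ≡ s
    c∙preimage s t = trans (∙-preimage c s t) (trans (cong₂ (λ e e′ → s * e + t * e′) c∙g₁≡1 c∙g₂≡0)
                       (trans (cong₂ _+_ (*-identityʳ s) (zeroʳ t)) (+-identityʳ s)))

    d∙preimage : ∀ s t → d ∙ preimage s t ≡ t
    d∙preimage s t = trans (∙-preimage d s t) (trans (cong₂ (λ e e′ → s * e + t * e′) d∙g₁≡0 d∙g₂≡1)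
                       (trans (cong₂ _+_ (zeroʳ s) (*-identityʳ t)) (+-identityˡ t)))

    preimage-· : ∀ μ s t → preimage (μ * s) (μ * t) ≈ μ · preimage s t
    preimage-· μ s t i = trans (cong₂ _+_ (*-assoc μ s (g₁ i)) (*-assoc μ t (g₂ i))) (sym (distribˡ μ _ _))

    preimage≉0 : ∀ {s t} → ¬ (s ≡ 0# × t ≡ 0#) → ¬ preimage s t ≈ 0ᵥ
    preimage≉0 {s} {t} st≢0 g≈0 = st≢0 (trans (sym (c∙preimage s t)) (trans (∙-congʳ c g≈0) (∙-zeroʳ c)) ,
                                       trans (sym (d∙preimage s t)) (trans (∙-congʳ d g≈0) (∙-zeroʳ d)))

    locate : ∀ s t → ¬ (s ≡ 0# × t ≡ 0#) → ∃[ l ] ∃[ μ ] (μ ≢ 0# × x l ≡ μ * s × y l ≡ μ * t)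
    locate s t st≢0 = l , λ′ ⁻¹ , x⁻¹≢0 λ′≢0 , solve s≡λ′xₗ , solve t≡λ′yₗ
      where
      cover = columns-cover (preimage s t) (preimage≉0 st≢0)
      l = proj₁ cover
      λ′ = proj₁ (proj₂ cover)
      g≈λ′Gₗ : preimage s t ≈ λ′ · column F G l
      g≈λ′Gₗ = proj₂ (proj₂ cover)
      s≡λ′xₗ : s ≡ λ′ * x l
      s≡λ′xₗ = trans (sym (c∙preimage s t))
        (trans (∙-congʳ c g≈λ′Gₗ) (trans (∙-·ʳ c (column F G l) λ′) (cong (λ′ *_) (c·G≈x l))))
      t≡λ′yₗ : t ≡ λ′ * y l
      t≡λ′yₗ = trans (sym (d∙preimage s t))
        (trans (∙-congʳ d g≈λ′Gₗ) (trans (∙-·ʳ d (column F G l) λ′) (cong (λ′ *_) (d·G≈y l))))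
      λ′≢0 : λ′ ≢ 0#
      λ′≢0 λ′≡0 = st≢0 (trans s≡λ′xₗ (trans (cong (_* x l) λ′≡0) (zeroˡ (x l))) ,
                        trans t≡λ′yₗ (trans (cong (_* y l) λ′≡0) (zeroˡ (y l))))
      solve : ∀ {a b} → a ≡ λ′ * b → b ≡ λ′ ⁻¹ * a
      solve {a} {b} a≡λ′b = trans (sym (x⁻¹*[x*y]≡y b λ′≢0)) (cong (λ′ ⁻¹ *_) (sym a≡λ′b))

    locate-slope : ∀ t → ∃[ l ] (x l ≢ 0# × y l ≡ x l * t)
    locate-slope t = l , (λ xₗ≡0 → μ≢0 (trans μ≡xₗ xₗ≡0)) , trans yₗ≡μt (cong (_* t) μ≡xₗ)
      where
      found = locate 1# t (λ (1≡0 , _) → 1≢0 1≡0)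
      l = proj₁ found
      μ = proj₁ (proj₂ found)
      μ≢0 : μ ≢ 0#
      μ≢0 = proj₁ (proj₂ (proj₂ found))
      μ≡xₗ : μ ≡ x l
      μ≡xₗ = sym (trans (proj₁ (proj₂ (proj₂ (proj₂ found)))) (*-identityʳ μ))
      yₗ≡μt : y l ≡ μ * t
      yₗ≡μt = proj₂ (proj₂ (proj₂ (proj₂ found)))

    locate-vertical : ∃[ l ] (x l ≡ 0# × y l ≢ 0#)
    locate-vertical =
      l , trans xₗ≡μ0 (zeroʳ μ) , λ yₗ≡0 → μ≢0 (trans (sym (*-identityʳ μ)) (trans (sym yₗ≡μ1) yₗ≡0))
      where
      found = locate 0# 1# (λ (_ , 1≡0) → 1≢0 1≡0)
      l = proj₁ found
      μ = proj₁ (proj₂ found)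
      μ≢0 : μ ≢ 0#
      μ≢0 = proj₁ (proj₂ (proj₂ found))
      xₗ≡μ0 : x l ≡ μ * 0#
      xₗ≡μ0 = proj₁ (proj₂ (proj₂ (proj₂ found)))
      yₗ≡μ1 : y l ≡ μ * 1#
      yₗ≡μ1 = proj₂ (proj₂ (proj₂ (proj₂ found)))

    residual : Fin ([ suc k ] q) → Vec F (suc k)
    residual l i = G i l + - preimage (x l) (y l) i

    ∙-residual : ∀ u l → u ∙ residual l ≡ u ∙ column F G l + - (u ∙ preimage (x l) (y l))
    ∙-residual u l = trans (∙-distribˡ-+ u (column F G l) (λ i → - preimage (x l) (y l) i))
                         (cong (u ∙ column F G l +_) (∙-negʳ u (preimage (x l) (y l))))

    -- A column in the span of g₁ and g₂ is determined up to scaling by the point (x l : y l) of the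
    -- projective line.
    span-too-small : (∀ l → residual l ≈ 0ᵥ) → [ suc k ] q ≤ [ 2 ] q
    span-too-small residual≈0 = Fin.injective⇒≤ {f = point} point-injective
      where
      in-span : ∀ l i → G i l ≡ preimage (x l) (y l) i
      in-span l i = x∙y⁻¹≈ε⇒x≈y _ _ (residual≈0 l i)

      pair : Fin ([ suc k ] q) → Vec F 2
      pair l = x l ∷ y l ∷ []

      pair≉0 : ∀ l → ¬ pair l ≈ 0ᵥ
      pair≉0 l pair≈0 = column-nonzero l (λ i → trans (in-span l i)
        (trans (cong₂ (λ a b → a * g₁ i + b * g₂ i) (pair≈0 zero) (pair≈0 (suc zero)))
               (trans (cong₂ _+_ (zeroˡ (g₁ i)) (zeroˡ (g₂ i))) (+-identityˡ 0#))))

      point : Fin ([ suc k ] q) → Fin ([ 2 ] q)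
      point l = projectivePoint (pair l) (pair≉0 l)

      point-injective : Injective _≡_ _≡_ point
      point-injective {l} {l′} e = proportional⇒≡ μ λ i → begin
        G i l                                  ≡⟨ in-span l i ⟩
        preimage (x l) (y l) i                 ≡⟨ cong₂ (λ a b → preimage a b i) (pair≈μpair 0F) (pair≈μpair 1F) ⟩
        preimage (μ * x l′) (μ * y l′) i       ≡⟨ preimage-· μ (x l′) (y l′) i ⟩
        μ * preimage (x l′) (y l′) i           ≡⟨ cong (μ *_) (in-span l′ i) ⟨
        μ * G i l′                             ∎
        where
        open ≡-Reasoning
        proportional = projectivePoint-injective (pair l) (pair l′) (pair≉0 l) (pair≉0 l′) e
        μ = proj₁ proportional
        pair≈μpair : pair l ≈ μ · pair l′
        pair≈μpair = proj₂ proportional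

    residual-in-kernel : ∀ l → ¬ residual l ≈ 0ᵥ → ∃[ l′ ] (x l′ ≡ 0# × y l′ ≡ 0#)
    residual-in-kernel l residual≉0 = l′ , vanish {c} c∙residual≡0 (c·G≈x l′) , vanish {d} d∙residual≡0 (d·G≈y l′)
      where
      cover = columns-cover (residual l) residual≉0
      l′ = proj₁ cover
      λ′ = proj₁ (proj₂ cover)
      residual≈λ′Gₗ′ : residual l ≈ λ′ · column F G l′
      residual≈λ′Gₗ′ = proj₂ (proj₂ cover)

      c∙residual≡0 : c ∙ residual l ≡ 0#
      c∙residual≡0 = trans (∙-residual c l)
        (trans (cong₂ (λ a b → a + - b) (c·G≈x l) (c∙preimage (x l) (y l))) (-‿inverseʳ (x l)))

      d∙residual≡0 : d ∙ residual l ≡ 0#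
      d∙residual≡0 = trans (∙-residual d l)
        (trans (cong₂ (λ a b → a + - b) (d·G≈y l) (d∙preimage (x l) (y l))) (-‿inverseʳ (y l)))

      λ′≢0 : λ′ ≢ 0#
      λ′≢0 λ′≡0 = residual≉0 λ i → trans (residual≈λ′Gₗ′ i) (trans (cong (_* G i l′) λ′≡0) (zeroˡ _))

      vanish : ∀ {u a} → u ∙ residual l ≡ 0# → combo F G u l′ ≡ a → a ≡ 0#
      vanish {u} {a} u∙residual≡0 u·Gₗ′≡a = x*y≡0⇒y≡0 λ′≢0 (begin
        λ′ * a                   ≡⟨ cong (λ′ *_) u·Gₗ′≡a ⟨
        λ′ * combo F G u l′      ≡⟨ ∙-·ʳ u (column F G l′) λ′ ⟨
        u ∙ (λ′ · column F G l′) ≡⟨ ∙-congʳ u residual≈λ′Gₗ′ ⟨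
        u ∙ residual l           ≡⟨ u∙residual≡0 ⟩
        0#                       ∎)
        where open ≡-Reasoning

    locate-zero : ¬ ([ suc k ] q ≤ [ 2 ] q) → ∃[ l ] (x l ≡ 0# × y l ≡ 0#)
    locate-zero too-long = residual-in-kernel (proj₁ outside-span) (proj₂ outside-span)
      where
      outside-span = Fin.¬∀⟶∃¬ _ (λ l → residual l ≈ 0ᵥ) (λ l → Fin.all? (λ i → residual l i ≟ 0#))
                                (too-long ∘ span-too-small)

    module Separation {a} (a≢0 : a ≢ 0#) (4<q^k : 4 ℕ.< q ^ k) where

      w : Vec F ([ suc k ] q)
      w l = x l + a * y l

      Separating : Vec F ([ suc k ] q) → Set
      Separating z = InSomeSimplex F (suc k) x z × InSomeSimplex F (suc k) y z × ¬ InSomeSimplex F (suc k) z w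

      w∈G : InCode F G w
      w∈G = (λ i → c i + a * d i) , λ l →
        trans (∙-distribʳ-+ c (a · d) (column F G l))
              (cong₂ _+_ (c·G≈x l) (trans (∙-·ˡ d (column F G l) a) (cong (a *_) (d·G≈y l))))

      x∼w : InSomeSimplex F (suc k) x w
      x∼w = G , G-simplex , (c , c·G≈x) , w∈G

      y∼w : InSomeSimplex F (suc k) y w
      y∼w = G , G-simplex , (d , d·G≈y) , w∈G

      -- The positions come out of an exhaustive search; opacity keeps the type checker from
      -- evaluating them.
      opaque
        L₁ L₂ L₃ : Fin ([ suc k ] q)
        L₁ = proj₁ locate-vertical
        L₂ = proj₁ (locate-slope 0#)
        L₃ = proj₁ (locate-slope (a ⁻¹))

        x₁≡0 : x L₁ ≡ 0#
        x₁≡0 = proj₁ (proj₂ locate-vertical)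

        y₁≢0 : y L₁ ≢ 0#
        y₁≢0 = proj₂ (proj₂ locate-vertical)

        x₂≢0 : x L₂ ≢ 0#
        x₂≢0 = proj₁ (proj₂ (locate-slope 0#))

        y₂≡0 : y L₂ ≡ 0#
        y₂≡0 = trans (proj₂ (proj₂ (locate-slope 0#))) (zeroʳ (x L₂))

        x₃≢0 : x L₃ ≢ 0#
        x₃≢0 = proj₁ (proj₂ (locate-slope (a ⁻¹)))

        y₃≡x₃a⁻¹ : y L₃ ≡ x L₃ * a ⁻¹
        y₃≡x₃a⁻¹ = proj₂ (proj₂ (locate-slope (a ⁻¹)))

      y₃≢0 : y L₃ ≢ 0#
      y₃≢0 y₃≡0 = x*y≢0 x₃≢0 (x⁻¹≢0 a≢0) (trans (sym y₃≡x₃a⁻¹) y₃≡0)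

      L₁≢L₂ : L₁ ≢ L₂
      L₁≢L₂ = distinguish x x₁≡0 x₂≢0

      L₁≢L₃ : L₁ ≢ L₃
      L₁≢L₃ = distinguish x x₁≡0 x₃≢0

      L₂≢L₃ : L₂ ≢ L₃
      L₂≢L₃ = distinguish y y₂≡0 y₃≢0

      w₁≡ay₁ : w L₁ ≡ a * y L₁
      w₁≡ay₁ = trans (cong (_+ a * y L₁) x₁≡0) (+-identityˡ _)

      w₁≢0 : w L₁ ≢ 0#
      w₁≢0 w₁≡0 = x*y≢0 a≢0 y₁≢0 (trans (sym w₁≡ay₁) w₁≡0)

      w₂≡x₂ : w L₂ ≡ x L₂
      w₂≡x₂ = trans (cong (λ b → x L₂ + a * b) y₂≡0) (trans (cong (x L₂ +_) (zeroʳ a)) (+-identityʳ (x L₂)))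

      w₂≢0 : w L₂ ≢ 0#
      w₂≢0 w₂≡0 = x₂≢0 (trans (sym w₂≡x₂) w₂≡0)

      w₃≡x₃+x₃ : w L₃ ≡ x L₃ + x L₃
      w₃≡x₃+x₃ = cong (x L₃ +_) (begin
        a * y L₃                 ≡⟨ cong (a *_) y₃≡x₃a⁻¹ ⟩
        a * (x L₃ * a ⁻¹)        ≡⟨ cong (a *_) (*-comm (x L₃) (a ⁻¹)) ⟩
        a * (a ⁻¹ * x L₃)        ≡⟨ x*[x⁻¹*y]≡y (x L₃) a≢0 ⟩
        x L₃                     ∎)
        where open ≡-Reasoning

      x₃x₂⁻¹w₂≡x₃ : x L₃ * x L₂ ⁻¹ * w L₂ ≡ x L₃
      x₃x₂⁻¹w₂≡x₃ = trans (cong (x L₃ * x L₂ ⁻¹ *_) w₂≡x₂) (x*y⁻¹*y≡x (x L₃) x₂≢0)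

      y₃y₁⁻¹w₁≡x₃ : y L₃ * y L₁ ⁻¹ * w L₁ ≡ x L₃
      y₃y₁⁻¹w₁≡x₃ = begin
        y L₃ * y L₁ ⁻¹ * w L₁            ≡⟨ cong (y L₃ * y L₁ ⁻¹ *_) (trans w₁≡ay₁ (*-comm a (y L₁))) ⟩
        y L₃ * y L₁ ⁻¹ * (y L₁ * a)      ≡⟨ *-assoc _ (y L₁) a ⟨
        y L₃ * y L₁ ⁻¹ * y L₁ * a        ≡⟨ cong (_* a) (x*y⁻¹*y≡x (y L₃) y₁≢0) ⟩
        y L₃ * a                         ≡⟨ cong (_* a) y₃≡x₃a⁻¹ ⟩
        x L₃ * a ⁻¹ * a                  ≡⟨ x*y⁻¹*y≡x (x L₃) a≢0 ⟩
        x L₃                             ∎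
        where open ≡-Reasoning

      -- z arises from w by exchanging the entries at L₂ and L₃ (fixing x) and rescaling the entry at
      -- L₁, and also by exchanging the entries at L₁ and L₃ (fixing y) and rescaling the one at L₂.
      -- At L₃ it is x L₃ rather than w L₃ = 2 x L₃.
      module Odd (1+1≢0 : 1# + 1# ≢ 0#) where

        w₃≢0 : w L₃ ≢ 0#
        w₃≢0 w₃≡0 = x*y≢0 1+1≢0 x₃≢0 (trans (sym (x+x≡[1+1]*x (x L₃))) (trans (sym w₃≡x₃+x₃) w₃≡0))

        c₁ c₂ : Carrier
        c₁ = y L₁ * y L₃ ⁻¹ * w L₃
        c₂ = x L₂ * x L₃ ⁻¹ * w L₃

        z z′ : Vec F ([ suc k ] q)
        z  = exchange x L₂ L₃ w [ L₁ ]≔ c₁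
        z′ = exchange y L₁ L₃ w [ L₂ ]≔ c₂

        x∼z : InSomeSimplex F (suc k) x z
        x∼z = rescale-step x₁≡0 (λ e → w₁≢0 (trans (sym (exchange-elsewhere x w L₁≢L₂ L₁≢L₃)) e))
                (x*y≢0 (x*y≢0 y₁≢0 (x⁻¹≢0 y₃≢0)) w₃≢0) (exchange-step L₂≢L₃ x₂≢0 x₃≢0 x∼w)

        y∼z′ : InSomeSimplex F (suc k) y z′
        y∼z′ = rescale-step y₂≡0 (λ e → w₂≢0 (trans (sym (exchange-elsewhere y w (≢-sym L₁≢L₂) L₂≢L₃)) e))
                 (x*y≢0 (x*y≢0 x₂≢0 (x⁻¹≢0 x₃≢0)) w₃≢0) (exchange-step L₁≢L₃ y₁≢0 y₃≢0 y∼w)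

        z₁ : z L₁ ≡ c₁
        z₁ = []≔-updates _ L₁

        z′₁ : z′ L₁ ≡ c₁
        z′₁ = trans ([]≔-minimal _ L₁≢L₂) (exchange-left y w L₁≢L₃)

        z₂ : z L₂ ≡ c₂
        z₂ = trans ([]≔-minimal _ (≢-sym L₁≢L₂)) (exchange-left x w L₂≢L₃)

        z′₂ : z′ L₂ ≡ c₂
        z′₂ = []≔-updates _ L₂

        z₃ : z L₃ ≡ x L₃
        z₃ = trans ([]≔-minimal _ (≢-sym L₁≢L₃)) (trans (exchange-right x w) x₃x₂⁻¹w₂≡x₃)

        z′₃ : z′ L₃ ≡ x L₃
        z′₃ = trans ([]≔-minimal _ (≢-sym L₂≢L₃)) (trans (exchange-right y w) y₃y₁⁻¹w₁≡x₃)

        S : Fin 3 → Fin ([ suc k ] q)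
        S = L₁ ∷ L₂ ∷ L₃ ∷ []

        z≡w-off-S : ∀ l → (∀ s → S s ≢ l) → z l ≡ w l
        z≡w-off-S l off = trans ([]≔-minimal _ (≢-sym (off 0F)))
          (exchange-elsewhere x w (≢-sym (off 1F)) (≢-sym (off 2F)))

        z′≡w-off-S : ∀ l → (∀ s → S s ≢ l) → z′ l ≡ w l
        z′≡w-off-S l off = trans ([]≔-minimal _ (≢-sym (off 1F)))
          (exchange-elsewhere y w (≢-sym (off 0F)) (≢-sym (off 2F)))

        z′≈z : z′ ≈ z
        z′≈z = by-positions (λ l → z′ l ≡ z l) S
          (λ where
            0F → trans z′₁ (sym z₁)
            1F → trans z′₂ (sym z₂)
            2F → trans z′₃ (sym z₃))
          (λ l off → trans (z′≡w-off-S l off) (sym (z≡w-off-S l off)))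

        z₃≢w₃ : z L₃ ≢ w L₃
        z₃≢w₃ z₃≡w₃ = x₃≢0 (x+x≈x⇒x≈0 (x L₃) (trans (sym w₃≡x₃+x₃) (trans (sym z₃≡w₃) z₃)))

        separating : ∃[ z ] Separating z
        separating = z , x∼z , InSomeSimplex-cong (λ _ → refl) z′≈z y∼z′ ,
          close⇒¬InSomeSimplex {z = z} {w} (ℕ.≤-trans (ℕ.n≤1+n 4) 4<q^k) S z≡w-off-S {L₃} z₃≢w₃

      module Characteristic2 (1+1≡0 : 1# + 1# ≡ 0#) where

        w₃≡0 : w L₃ ≡ 0#
        w₃≡0 = trans w₃≡x₃+x₃ (trans (x+x≡[1+1]*x (x L₃)) (trans (cong (_* x L₃) 1+1≡0) (zeroˡ (x L₃))))

        -- Now w L₃ = 0 cannot be rescaled into the entries at L₁ and L₂, so w L₄ is first moved to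
        -- L₃; then z is built as in the odd case, and it vanishes at L₄ where w does not.
        module Slope {t} (t≢0 : t ≢ 0#) (t≢a⁻¹ : t ≢ a ⁻¹) where

          opaque
            L₄ : Fin ([ suc k ] q)
            L₄ = proj₁ (locate-slope t)

            x₄≢0 : x L₄ ≢ 0#
            x₄≢0 = proj₁ (proj₂ (locate-slope t))

            y₄≡x₄t : y L₄ ≡ x L₄ * t
            y₄≡x₄t = proj₂ (proj₂ (locate-slope t))

          y₄≢0 : y L₄ ≢ 0#
          y₄≢0 y₄≡0 = x*y≢0 x₄≢0 t≢0 (trans (sym y₄≡x₄t) y₄≡0)

          -- In characteristic 2, x + a y vanishes exactly where y = a⁻¹ x.
          w₄≢0 : w L₄ ≢ 0#
          w₄≢0 w₄≡0 = t≢a⁻¹ (begin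
            t               ≡⟨ x⁻¹*[x*y]≡y t a≢0 ⟨
            a ⁻¹ * (a * t)  ≡⟨ cong (a ⁻¹ *_) at≡1 ⟩
            a ⁻¹ * 1#       ≡⟨ *-identityʳ (a ⁻¹) ⟩
            a ⁻¹            ∎)
            where
            open ≡-Reasoning
            1+at≡0 : 1# + a * t ≡ 0#
            1+at≡0 = x*y≡0⇒y≡0 x₄≢0 (begin
              x L₄ * (1# + a * t)          ≡⟨ distribˡ (x L₄) 1# (a * t) ⟩
              x L₄ * 1# + x L₄ * (a * t)   ≡⟨ cong₂ _+_ (*-identityʳ (x L₄)) (x*[y*z]≡y*[x*z] (x L₄) a t) ⟩
              x L₄ + a * (x L₄ * t)        ≡⟨ cong (λ b → x L₄ + a * b) y₄≡x₄t ⟨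
              w L₄                         ≡⟨ w₄≡0 ⟩
              0#                           ∎)
            at≡1 : a * t ≡ 1#
            at≡1 = begin
              a * t                        ≡⟨ +-identityˡ (a * t) ⟨
              0# + a * t                   ≡⟨ cong (_+ a * t) 1+1≡0 ⟨
              1# + 1# + a * t              ≡⟨ +-assoc 1# 1# (a * t) ⟩
              1# + (1# + a * t)            ≡⟨ cong (1# +_) 1+at≡0 ⟩
              1# + 0#                      ≡⟨ +-identityʳ 1# ⟩
              1#                           ∎

          L₁≢L₄ : L₁ ≢ L₄
          L₁≢L₄ = distinguish x x₁≡0 x₄≢0

          L₂≢L₄ : L₂ ≢ L₄
          L₂≢L₄ = distinguish y y₂≡0 y₄≢0

          L₃≢L₄ : L₃ ≢ L₄
          L₃≢L₄ L₃≡L₄ = t≢a⁻¹ (sym (*-cancelˡ x₃≢0 (begin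
            x L₃ * a ⁻¹   ≡⟨ y₃≡x₃a⁻¹ ⟨
            y L₃          ≡⟨ cong y L₃≡L₄ ⟩
            y L₄          ≡⟨ y₄≡x₄t ⟩
            x L₄ * t      ≡⟨ cong (λ l → x l * t) L₃≡L₄ ⟨
            x L₃ * t      ∎)))
            where open ≡-Reasoning

          c₁ c₂ : Carrier
          c₁ = y L₁ * y L₃ ⁻¹ * (y L₃ * y L₄ ⁻¹ * w L₄)
          c₂ = x L₂ * x L₃ ⁻¹ * (x L₃ * x L₄ ⁻¹ * w L₄)

          z z′ : Vec F ([ suc k ] q)
          z  = exchange x L₂ L₃ (exchange x L₃ L₄ w) [ L₁ ]≔ c₁
          z′ = exchange y L₁ L₃ (exchange y L₃ L₄ w) [ L₂ ]≔ c₂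

          x∼z : InSomeSimplex F (suc k) x z
          x∼z = rescale-step x₁≡0
            (λ e → w₁≢0 (trans (sym (trans (exchange-elsewhere x _ L₁≢L₂ L₁≢L₃)
                                             (exchange-elsewhere x w L₁≢L₃ L₁≢L₄))) e))
            (x*y≢0 (x*y≢0 y₁≢0 (x⁻¹≢0 y₃≢0)) (x*y≢0 (x*y≢0 y₃≢0 (x⁻¹≢0 y₄≢0)) w₄≢0))
            (exchange-step L₂≢L₃ x₂≢0 x₃≢0 (exchange-step L₃≢L₄ x₃≢0 x₄≢0 x∼w))

          y∼z′ : InSomeSimplex F (suc k) y z′
          y∼z′ = rescale-step y₂≡0
            (λ e → w₂≢0 (trans (sym (trans (exchange-elsewhere y _ (≢-sym L₁≢L₂) L₂≢L₃)
                                             (exchange-elsewhere y w L₂≢L₃ L₂≢L₄))) e))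
            (x*y≢0 (x*y≢0 x₂≢0 (x⁻¹≢0 x₃≢0)) (x*y≢0 (x*y≢0 x₃≢0 (x⁻¹≢0 x₄≢0)) w₄≢0))
            (exchange-step L₁≢L₃ y₁≢0 y₃≢0 (exchange-step L₃≢L₄ y₃≢0 y₄≢0 y∼w))

          z₁ : z L₁ ≡ c₁
          z₁ = []≔-updates _ L₁

          z′₁ : z′ L₁ ≡ c₁
          z′₁ = trans ([]≔-minimal _ L₁≢L₂) (trans (exchange-left y _ L₁≢L₃)
                  (cong (y L₁ * y L₃ ⁻¹ *_) (exchange-left y w L₃≢L₄)))

          z₂ : z L₂ ≡ c₂
          z₂ = trans ([]≔-minimal _ (≢-sym L₁≢L₂)) (trans (exchange-left x _ L₂≢L₃)
                 (cong (x L₂ * x L₃ ⁻¹ *_) (exchange-left x w L₃≢L₄)))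

          z′₂ : z′ L₂ ≡ c₂
          z′₂ = []≔-updates _ L₂

          z₃ : z L₃ ≡ x L₃
          z₃ = trans ([]≔-minimal _ (≢-sym L₁≢L₃)) (trans (exchange-right x _)
                 (trans (cong (x L₃ * x L₂ ⁻¹ *_) (exchange-elsewhere x w L₂≢L₃ L₂≢L₄)) x₃x₂⁻¹w₂≡x₃))

          z′₃ : z′ L₃ ≡ x L₃
          z′₃ = trans ([]≔-minimal _ (≢-sym L₂≢L₃)) (trans (exchange-right y _)
                  (trans (cong (y L₃ * y L₁ ⁻¹ *_) (exchange-elsewhere y w L₁≢L₃ L₁≢L₄)) y₃y₁⁻¹w₁≡x₃))

          z₄ : z L₄ ≡ 0#
          z₄ = trans ([]≔-minimal _ (≢-sym L₁≢L₄)) (trans (exchange-elsewhere x _ (≢-sym L₂≢L₄) (≢-sym L₃≢L₄))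
                 (trans (exchange-right x w) (y≡0⇒x*y≡0 _ w₃≡0)))

          z′₄ : z′ L₄ ≡ 0#
          z′₄ = trans ([]≔-minimal _ (≢-sym L₂≢L₄)) (trans (exchange-elsewhere y _ (≢-sym L₁≢L₄) (≢-sym L₃≢L₄))
                  (trans (exchange-right y w) (y≡0⇒x*y≡0 _ w₃≡0)))

          S : Fin 4 → Fin ([ suc k ] q)
          S = L₁ ∷ L₂ ∷ L₃ ∷ L₄ ∷ []

          z≡w-off-S : ∀ l → (∀ s → S s ≢ l) → z l ≡ w l
          z≡w-off-S l off = trans ([]≔-minimal _ (≢-sym (off 0F)))
            (trans (exchange-elsewhere x _ (≢-sym (off 1F)) (≢-sym (off 2F)))
                   (exchange-elsewhere x w (≢-sym (off 2F)) (≢-sym (off 3F))))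

          z′≡w-off-S : ∀ l → (∀ s → S s ≢ l) → z′ l ≡ w l
          z′≡w-off-S l off = trans ([]≔-minimal _ (≢-sym (off 1F)))
            (trans (exchange-elsewhere y _ (≢-sym (off 0F)) (≢-sym (off 2F)))
                   (exchange-elsewhere y w (≢-sym (off 2F)) (≢-sym (off 3F))))

          z′≈z : z′ ≈ z
          z′≈z = by-positions (λ l → z′ l ≡ z l) S
            (λ where
              0F → trans z′₁ (sym z₁)
              1F → trans z′₂ (sym z₂)
              2F → trans z′₃ (sym z₃)
              3F → trans z′₄ (sym z₄))
            (λ l off → trans (z′≡w-off-S l off) (sym (z≡w-off-S l off)))

          separating : ∃[ z ] Separating z
          separating = z , x∼z , InSomeSimplex-cong (λ _ → refl) z′≈z y∼z′ ,
            close⇒¬InSomeSimplex {z = z} {w} 4<q^k S z≡w-off-S {L₄} (λ z₄≡w₄ → w₄≢0 (trans (sym z₄≡w₄) z₄))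

        -- z arises from w by swapping the entries at L₀ and L₁ (where x vanishes) and exchanging
        -- those at L₂ and L₃, and also by swapping L₀ and L₂ (where y vanishes) and exchanging L₁
        -- and L₃. At L₃ it is x L₃, whereas w L₃ = 0.
        module Origin (too-long : ¬ ([ suc k ] q ≤ [ 2 ] q)) where

          opaque
            L₀ : Fin ([ suc k ] q)
            L₀ = proj₁ (locate-zero too-long)

            x₀≡0 : x L₀ ≡ 0#
            x₀≡0 = proj₁ (proj₂ (locate-zero too-long))

            y₀≡0 : y L₀ ≡ 0#
            y₀≡0 = proj₂ (proj₂ (locate-zero too-long))

          w₀≡0 : w L₀ ≡ 0#
          w₀≡0 = trans (cong₂ _+_ x₀≡0 (y≡0⇒x*y≡0 a y₀≡0)) (+-identityʳ 0#)

          L₀≢L₁ : L₀ ≢ L₁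
          L₀≢L₁ = distinguish y y₀≡0 y₁≢0

          L₀≢L₂ : L₀ ≢ L₂
          L₀≢L₂ = distinguish x x₀≡0 x₂≢0

          L₀≢L₃ : L₀ ≢ L₃
          L₀≢L₃ = distinguish x x₀≡0 x₃≢0

          both-zero : ∀ (u : Vec F ([ suc k ] q)) {l l′} s → u l ≡ 0# → u l′ ≡ 0# → s * u l′ ≡ u l
          both-zero u s uₗ≡0 uₗ′≡0 = trans (y≡0⇒x*y≡0 s uₗ′≡0) (sym uₗ≡0)

          s : Carrier
          s = w L₁ * w L₂ ⁻¹

          v v′ z z′ : Vec F ([ suc k ] q)
          v  = w [ L₀ ]≔ 1# * w L₁ [ L₁ ]≔ 1# * w L₀
          v′ = w [ L₀ ]≔ s * w L₂ [ L₂ ]≔ 1# * w L₀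
          z  = exchange x L₂ L₃ v
          z′ = exchange y L₁ L₃ v′

          x∼z : InSomeSimplex F (suc k) x z
          x∼z = exchange-step L₂≢L₃ x₂≢0 x₃≢0
            (swap-step L₀≢L₁ 1≢0 1≢0 (both-zero x 1# x₀≡0 x₁≡0) (both-zero x 1# x₁≡0 x₀≡0) x∼w)

          y∼z′ : InSomeSimplex F (suc k) y z′
          y∼z′ = exchange-step L₁≢L₃ y₁≢0 y₃≢0
            (swap-step L₀≢L₂ (x*y≢0 w₁≢0 (x⁻¹≢0 w₂≢0)) 1≢0
                       (both-zero y s y₀≡0 y₂≡0) (both-zero y 1# y₂≡0 y₀≡0) y∼w)

          v-elsewhere : ∀ {l} → l ≢ L₀ → l ≢ L₁ → v l ≡ w l
          v-elsewhere l≢L₀ l≢L₁ = trans ([]≔-minimal _ l≢L₁) ([]≔-minimal w l≢L₀)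

          v′-elsewhere : ∀ {l} → l ≢ L₀ → l ≢ L₂ → v′ l ≡ w l
          v′-elsewhere l≢L₀ l≢L₂ = trans ([]≔-minimal _ l≢L₂) ([]≔-minimal w l≢L₀)

          z₀ : z L₀ ≡ w L₁
          z₀ = trans (exchange-elsewhere x v L₀≢L₂ L₀≢L₃)
                 (trans ([]≔-minimal _ L₀≢L₁) (trans ([]≔-updates w L₀) (*-identityˡ (w L₁))))

          z′₀ : z′ L₀ ≡ w L₁
          z′₀ = trans (exchange-elsewhere y v′ L₀≢L₁ L₀≢L₃)
                  (trans ([]≔-minimal _ L₀≢L₂) (trans ([]≔-updates w L₀) (x*y⁻¹*y≡x (w L₁) w₂≢0)))

          z₁ : z L₁ ≡ 0#
          z₁ = trans (exchange-elsewhere x v L₁≢L₂ L₁≢L₃) (trans ([]≔-updates _ L₁) (y≡0⇒x*y≡0 1# w₀≡0))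

          z′₁ : z′ L₁ ≡ 0#
          z′₁ = trans (exchange-left y v′ L₁≢L₃)
                  (y≡0⇒x*y≡0 _ (trans (v′-elsewhere (≢-sym L₀≢L₃) (≢-sym L₂≢L₃)) w₃≡0))

          z₂ : z L₂ ≡ 0#
          z₂ = trans (exchange-left x v L₂≢L₃)
                 (y≡0⇒x*y≡0 _ (trans (v-elsewhere (≢-sym L₀≢L₃) (≢-sym L₁≢L₃)) w₃≡0))

          z′₂ : z′ L₂ ≡ 0#
          z′₂ = trans (exchange-elsewhere y v′ (≢-sym L₁≢L₂) L₂≢L₃)
                  (trans ([]≔-updates _ L₂) (y≡0⇒x*y≡0 1# w₀≡0))

          z₃ : z L₃ ≡ x L₃
          z₃ = trans (exchange-right x v)
                 (trans (cong (x L₃ * x L₂ ⁻¹ *_) (v-elsewhere (≢-sym L₀≢L₂) (≢-sym L₁≢L₂))) x₃x₂⁻¹w₂≡x₃)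

          z′₃ : z′ L₃ ≡ x L₃
          z′₃ = trans (exchange-right y v′)
                  (trans (cong (y L₃ * y L₁ ⁻¹ *_) (v′-elsewhere (≢-sym L₀≢L₁) L₁≢L₂)) y₃y₁⁻¹w₁≡x₃)

          S : Fin 4 → Fin ([ suc k ] q)
          S = L₀ ∷ L₁ ∷ L₂ ∷ L₃ ∷ []

          z≡w-off-S : ∀ l → (∀ s → S s ≢ l) → z l ≡ w l
          z≡w-off-S l off = trans (exchange-elsewhere x v (≢-sym (off 2F)) (≢-sym (off 3F)))
                                  (v-elsewhere (≢-sym (off 0F)) (≢-sym (off 1F)))

          z′≡w-off-S : ∀ l → (∀ s → S s ≢ l) → z′ l ≡ w l
          z′≡w-off-S l off = trans (exchange-elsewhere y v′ (≢-sym (off 1F)) (≢-sym (off 3F)))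
                                   (v′-elsewhere (≢-sym (off 0F)) (≢-sym (off 2F)))

          z′≈z : z′ ≈ z
          z′≈z = by-positions (λ l → z′ l ≡ z l) S
            (λ where
              0F → trans z′₀ (sym z₀)
              1F → trans z′₁ (sym z₁)
              2F → trans z′₂ (sym z₂)
              3F → trans z′₃ (sym z₃))
            (λ l off → trans (z′≡w-off-S l off) (sym (z≡w-off-S l off)))

          separating : ∃[ z ] Separating z
          separating = z , x∼z , InSomeSimplex-cong (λ _ → refl) z′≈z y∼z′ ,
            close⇒¬InSomeSimplex {z = z} {w} 4<q^k S z≡w-off-S {L₃}
              (λ z₃≡w₃ → x₃≢0 (trans (sym z₃) (trans z₃≡w₃ w₃≡0)))

      separating : ∃[ z ] Separating z
      separating with 1# + 1# ≟ 0# | q ℕ.≤? 2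
      ... | no 1+1≢0  | _       = Odd.separating 1+1≢0
      ... | yes 1+1≡0 | yes q≤2 = Characteristic2.Origin.separating 1+1≡0 ([1+k]≰[2] {k = k} q≤2 4<q^k)
      ... | yes 1+1≡0 | no q≰2  =
        Characteristic2.Slope.separating 1+1≡0 {proj₁ third} (proj₁ (proj₂ third)) (proj₂ (proj₂ third))
        where third = third-element (a ⁻¹) (ℕ.≰⇒> q≰2)

lemma3 : (q k : ℕ) (F : FiniteField q) → IsPrimePower q → 2 ≤ k
    → ((k ≡ 2 × 5 ≤ q) ⊎ (4 ≤ k × q ≡ 2) ⊎ (3 ≤ k × 3 ≤ q))
    → (x y : Vec F ([ k ] q))
    → LinIndep₂ F x y
    → InSomeSimplex F k x y
    → (a : FiniteField.Carrier F) → a ≢ FiniteField.0# F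
    → ∃[ z ] (InSomeSimplex F k x z × InSomeSimplex F k y z
              × ¬ InSomeSimplex F k z (_+ᵥ_ F x (_•_ F a y)))
lemma3 q (suc (suc m)) F _ (s≤s (s≤s z≤n)) k-range x y independent
       (G , G-simplex , (c , c·G≈x) , (d , d·G≈y)) a a≢0 =
  Separation.separating a≢0 (4<q^[k-1] q m k-range)
  where
  open Theory F
  open Frame G-simplex {c = c} {d} c·G≈x d·G≈y independent
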